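{- Let $G$ be a parity game, $v$ a vertex, and $\sigma$ a (history-dependent) strategy for player Odd that is oblivious with respect to odd-dominated cycles, i.e. $\sigma(\lambda\,u\,\lambda'\,u\,\lambda'')=\sigma(\lambda\,u\,\lambda'')$ whenever $u\,\lambda'\,u$ is an odd-dominated cycle. Then $\min_{\pi\in\mathrm{Plays}(\sigma,v)}\theta_\Diamond(\pi)\in\mathbb M^\Diamond$.
   Context: Parity game $G=(V,E,\mathcal P,(V_\Diamond,V_\square))$: finite $V$ partitioned into $V_\Diamond$ (Even) and $V_\square$ (Odd), total $E$, priorities $\mathcal P:V\to\mathbb N$; a play is won by Even iff the least priority occurring infinitely often is even. A strategy for Odd maps every finite path ending in a vertex of $V_\square$ to a successor of that vertex; $\mathrm{Plays}(\sigma,v)$ is the set of plays starting in $v$ consistent with $\sigma$. An odd-dominated cycle is a path $u\,\lambda'\,u$ from a vertex back to itself whose minimal priority is odd. $V_i$ = vertices of priority $i$; $d$ = one more than the largest priority. $\mathbb M^\Diamond$: $\{\top\}$ plus $d$-tuples in $\mathbb N^d$ with $0$ at even positions and value $\le |V_i|$ at each odd position $i$. $\mathbb M^\Diamond_{ext}$: $\{\top\}$ plus $d$-tuples in $\mathbb N^d$ with $0$ at even positions. Ordered lexicographically, every tuple $<\top$. Play value $\theta_\Diamond(\pi)\in\mathbb M^\Diamond_{ext}$: $\top$ if $\pi$ is won by Odd; otherwise the tuple with $0$ at even positions and, at odd position $i$, the maximal number of priority-$i$ vertices in a prefix of $\pi$ whose minimal priority is $i$ ($0$ if there is no such prefix).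 The minimum is taken in this order. -}

module Defs where

open import Data.Nat using (ℕ; zero; suc; _+_; _*_; _≤_; _<_; _⊓_; _⊔_; _≟_)
open import Data.Fin using (Fin; toℕ)
open import Data.List using (List; []; _∷_; _++_; _∷ʳ_; length; filter; map; foldr; allFin)
open import Data.Vec using (Vec; lookup)
import Data.Vec as Vec
open import Data.Product using (Σ; ∃; _×_; _,_)
open import Data.Sum using (_⊎_)
open import Relation.Binary.PropositionalEquality using (_≡_; _≢_)
open import Relation.Nullary using (¬_)
open import Data.Unit using (⊤; tt)
open import Data.Empty using (⊥)

IsEven : ℕ → Set
IsEven n = ∃ λ k → n ≡ 2 * k

IsOdd : ℕ → Set
IsOdd n = ∃ λ k → n ≡ suc (2 * k)

data Player : Set where
  Even Odd : Player

record Game : Set₁ where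
  field
    n     : ℕ
    E     : Fin n → Fin n → Set
    total : ∀ u → ∃ λ w → E u w
    pr    : Fin n → ℕ
    owner : Fin n → Player                      -- Even = V◇, Odd = V□

module _ (G : Game) where
  open Game G

  V : Set
  V = Fin n

  d : ℕ
  d = suc (foldr _⊔_ 0 (map pr (allFin n)))

  sizeV : ℕ → ℕ
  sizeV i = length (filter (λ x → pr x ≟ i) (allFin n))

  IsPath : List V → Set
  IsPath []            = ⊤
  IsPath (x ∷ [])      = ⊤
  IsPath (x ∷ y ∷ xs)  = E x y × IsPath (y ∷ xs)

  -- minimal priority of the nonempty list u ∷ xs
  minPr : V → List V → ℕ
  minPr u xs = foldr (λ x m → pr x ⊓ m) (pr u) xs

  countPr : ℕ → List V → ℕ
  countPr i xs = length (filter (λ x → pr x ≟ i) xs)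

  Last : List V → V → Set
  Last p w = ∃ λ xs → p ≡ xs ∷ʳ w

  -- strategies for Odd: a function on finite paths (given as lists),
  -- choosing a successor of the last vertex whenever that vertex is Odd's.
  -- (Values on non-paths / paths ending in Even vertices are irrelevant.)
  record OddStrategy : Set where
    field
      σ     : List V → V
      legal : ∀ p w → IsPath p → Last p w → owner w ≡ Odd → E w (σ p)

  OddDominatedCycle : V → List V → Set
  OddDominatedCycle u λ′ = IsPath (u ∷ λ′ ∷ʳ u) × IsOdd (minPr u (λ′ ∷ʳ u))

  Oblivious : OddStrategy → Set
  Oblivious s = ∀ (λ₀ : List V) (u : V) (λ′ λ″ : List V) (w : V) →
    IsPath (λ₀ ++ u ∷ λ′ ++ u ∷ λ″) →
    Last (λ₀ ++ u ∷ λ′ ++ u ∷ λ″) w → owner w ≡ Odd →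
    OddDominatedCycle u λ′ →
    OddStrategy.σ s (λ₀ ++ u ∷ λ′ ++ u ∷ λ″) ≡ OddStrategy.σ s (λ₀ ++ u ∷ λ″)

  Play : Set
  Play = ℕ → V

  -- prefix of length k : π 0 … π (k-1)
  pre : Play → ℕ → List V
  pre π zero    = []
  pre π (suc k) = pre π k ∷ʳ π k

  InPlays : OddStrategy → V → Play → Set
  InPlays s v π =
    (π 0 ≡ v) ×
    (∀ i → E (π i) (π (suc i))) ×
    (∀ i → owner (π i) ≡ Odd → π (suc i) ≡ OddStrategy.σ s (pre π (suc i)))

  InfOften : Play → ℕ → Set
  InfOften π p = ∀ m → ∃ λ k → m ≤ k × pr (π k) ≡ p

  LeastInfOften : Play → ℕ → Set
  LeastInfOften π p = InfOften π p × (∀ q → q < p → ¬ InfOften π q)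

  WonByEven : Play → Set
  WonByEven π = ∃ λ p → LeastInfOften π p × IsEven p

  WonByOdd : Play → Set
  WonByOdd π = ∃ λ p → LeastInfOften π p × IsOdd p

  -- the extended measure space 𝕄◇_ext (without the parity side condition,
  -- which is imposed separately) : ⊤ or a d-tuple of naturals
  data Meas : Set where
    top : Meas
    tup : Vec ℕ d → Meas

  -- lexicographic order on tuples (position 0 most significant)
  LexLeq : ∀ {m} → Vec ℕ m → Vec ℕ m → Set
  LexLeq Vec.[] Vec.[] = ⊤
  LexLeq (x Vec.∷ xs) (y Vec.∷ ys) = x < y ⊎ (x ≡ y × LexLeq xs ys)

  _≤M_ : Meas → Meas → Set
  _     ≤M top   = ⊤
  top   ≤M tup _ = ⊥
  tup f ≤M tup g = LexLeq f g

  InM : Meas → Set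
  InM top     = ⊤
  InM (tup f) = (∀ i → IsEven (toℕ i) → lookup f i ≡ 0) ×
                (∀ i → IsOdd (toℕ i) → lookup f i ≤ sizeV (toℕ i))

  -- c is the maximal number of priority-i vertices (occurrences) in a
  -- (nonempty) prefix of π whose minimal priority is i; 0 if there is none
  MaxCount : Play → ℕ → ℕ → Set
  MaxCount π i c =
    (∀ k → minPr (π 0) (pre π (suc k)) ≡ i → countPr i (pre π (suc k)) ≤ c) ×
    ((∃ λ k → minPr (π 0) (pre π (suc k)) ≡ i × countPr i (pre π (suc k)) ≡ c)
     ⊎ ((∀ k → minPr (π 0) (pre π (suc k)) ≢ i) × c ≡ 0))

  PlayValue : Play → Meas → Set
  PlayValue π t =
    (WonByOdd π × t ≡ top) ⊎
    (WonByEven π × ∃ λ f → t ≡ tup f ×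
       (∀ i → IsEven (toℕ i) → lookup f i ≡ 0) ×
       (∀ i → IsOdd (toℕ i) → MaxCount π (toℕ i) (lookup f i)))

  IsMinValue : OddStrategy → V → Meas → Set
  IsMinValue s v m =
    (∃ λ π → InPlays s v π × PlayValue π m) ×
    (∀ π t → InPlays s v π → PlayValue π t → m ≤M t)

-- Suppose an odd entry f i of the minimal value exceeded |V_i|.  The prefix
-- of a minimal play realising f i then holds more than |V_i| occurrences of
-- priority-i vertices, so some vertex u of priority i occurs twice in it.
-- All priorities on that prefix are at least i, hence the stretch between the
-- two occurrences of u is an odd-dominated cycle.  Cutting it out gives, by
-- obliviousness, another play consistent with σ, still won by Even (it has
-- the same tail), whose prefixes are bounded by those of the original one and
-- lose at least the occurrence of u at priority i.  Its value is therefore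
-- lexicographically smaller than f, contradicting minimality.  The value of
-- the new play is a maximum over infinitely many prefixes, so it exists only
-- classically; this suffices since the contradiction is a negative statement.
module Submission where

open import Defs
open import Data.Empty using (⊥; ⊥-elim)
open import Data.Fin using (Fin; toℕ; zero; suc) renaming (_≟_ to _≟ᶠ_)
open import Data.Nat
open import Data.Nat.Properties
open import Data.Nat.Tactic.RingSolver using (solve-∀)
open import Data.List using (List; []; _∷_; _++_; _∷ʳ_; [_]; length; filter; foldr; allFin)
open import Data.List.Properties
  using (foldr-++; length-++; length-++-sucʳ; filter-++; filter-accept; filter-reject; ++-assoc; ++-identityʳ)
open import Data.List.Membership.Propositional using (_∈_)
open import Data.List.Membership.Propositional.Properties
  using (∈-∃++; ∈-++⁻; ∈-++⁺ˡ; ∈-++⁺ʳ; ∈-filter⁻; ∈-filter⁺; ∈-allFin)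
open import Data.List.Relation.Binary.Subset.Propositional using (_⊆_)
open import Data.List.Relation.Unary.Any using (here; there)
open import Data.List.Relation.Unary.All as All using (All; []; _∷_)
open import Data.List.Relation.Unary.AllPairs using ([]; _∷_)
open import Data.List.Relation.Unary.Unique.Propositional using (Unique)
import Data.List.Relation.Unary.Unique.Propositional.Properties as Unique
open import Data.Vec using (Vec; []; _∷_; lookup)
open import Data.Product using (∃; ∃₂; _×_; _,_; proj₁; proj₂)
open import Data.Sum using (_⊎_; inj₁; inj₂; map₂)
open import Data.Unit using (tt)
open import Effect.Monad using (RawMonad)
open import Function using (_∘_)
open import Level using (0ℓ)
open import Relation.Nullary using (¬_; yes; no)
open import Relation.Nullary.Negation using (¬¬-Monad)
open import Relation.Nullary.Decidable using (¬¬-excluded-middle)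
open import Relation.Unary using (Decidable)
open import Relation.Binary.PropositionalEquality
  using (_≡_; refl; sym; trans; cong; cong₂; subst; subst₂; module ≡-Reasoning)

open RawMonad (¬¬-Monad {a = 0ℓ})

¬¬-greatest : (P : ℕ → Set) (b : ℕ) → (∀ x → P x → x ≤ b) →
  ¬ ¬ (∃ λ c → (∀ x → P x → x ≤ c) × (P c ⊎ ((∀ x → ¬ P x) × c ≡ 0)))
¬¬-greatest P zero bounded = ¬¬-excluded-middle >>= λ where
  (yes p) → pure (0 , bounded , inj₁ p)
  (no ¬p) → pure (0 , bounded , inj₂ ((λ x px → ¬p (subst P (n≤0⇒n≡0 (bounded x px)) px)) , refl))
¬¬-greatest P (suc b) bounded = ¬¬-excluded-middle >>= λ where
  (yes p) → pure (suc b , bounded , inj₁ p)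
  (no ¬p) → ¬¬-greatest P b λ x px → ≤-pred (≤∧≢⇒< (bounded x px) (λ x≡ → ¬p (subst P x≡ px)))

¬¬-finite-choice : ∀ {A : Set} {m} (Q : Fin m → A → Set) → (∀ j → ¬ ¬ ∃ (Q j)) →
  ¬ ¬ (∃ λ (g : Vec A m) → ∀ j → Q j (lookup g j))
¬¬-finite-choice {m = zero} Q choose = pure ([] , λ ())
¬¬-finite-choice {m = suc m} Q choose = do
  c , q ← choose zero
  g , qs ← ¬¬-finite-choice (Q ∘ suc) (choose ∘ suc)
  pure (c ∷ g , λ { zero → q ; (suc j) → qs j })

even∧odd⇒⊥ : ∀ {x} → IsEven x → IsOdd x → ⊥
even∧odd⇒⊥ (k , refl) (l , eq) = even≢odd k l eq

Unique-⊆⇒length≤ : ∀ {A : Set} {xs ys : List A} → Unique xs → xs ⊆ ys → length xs ≤ length ys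
Unique-⊆⇒length≤ {xs = []} _ _ = z≤n
Unique-⊆⇒length≤ {xs = x ∷ xs} (x∉xs ∷ unique) xs⊆ys with ∈-∃++ (xs⊆ys (here refl))
... | ys₁ , ys₂ , refl =
  subst (suc (length xs) ≤_) (sym (length-++-sucʳ ys₁ x ys₂)) (s≤s (Unique-⊆⇒length≤ unique xs⊆ys₁ys₂))
  where
  xs⊆ys₁ys₂ : xs ⊆ ys₁ ++ ys₂
  xs⊆ys₁ys₂ y∈xs with ∈-++⁻ ys₁ (xs⊆ys (there y∈xs))
  ... | inj₁ y∈ys₁ = ∈-++⁺ˡ y∈ys₁
  ... | inj₂ (here y≡x) = ⊥-elim (All.lookup x∉xs y∈xs (sym y≡x))
  ... | inj₂ (there y∈ys₂) = ∈-++⁺ʳ ys₁ y∈ys₂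

suffix : ∀ {A : Set} → (ℕ → A) → ℕ → ℕ → A
suffix π m k = π (m + k)

module PlayFacts (G : Game) where
  open Game G using (E; pr)
  open import Data.List.Membership.DecPropositional (_≟ᶠ_ {Game.n G}) using (_∈?_)

  pointwise≤∧<⇒¬LexLeq : ∀ {m} (f g : Vec ℕ m) (i : Fin m) → (∀ j → lookup g j ≤ lookup f j) →
    lookup g i < lookup f i → ¬ LexLeq G f g
  pointwise≤∧<⇒¬LexLeq (x ∷ f) (y ∷ g) i g≤f g<f (inj₁ x<y) = <⇒≱ x<y (g≤f zero)
  pointwise≤∧<⇒¬LexLeq (x ∷ f) (y ∷ g) zero g≤f g<f (inj₂ (refl , _)) = <-irrefl refl g<f
  pointwise≤∧<⇒¬LexLeq (x ∷ f) (y ∷ g) (suc i) g≤f g<f (inj₂ (_ , lex)) =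
    pointwise≤∧<⇒¬LexLeq f g i (g≤f ∘ suc) g<f lex

  minFrom : ℕ → List (V G) → ℕ
  minFrom = foldr (λ x m → pr x ⊓ m)

  minFrom-≤-∈ : ∀ {x} z xs → x ∈ xs → minFrom z xs ≤ pr x
  minFrom-≤-∈ z (y ∷ xs) (here refl) = m⊓n≤m (pr y) _
  minFrom-≤-∈ z (y ∷ xs) (there x∈xs) = ≤-trans (m⊓n≤n (pr y) _) (minFrom-≤-∈ z xs x∈xs)

  minFrom-base : ∀ z xs → All (λ x → z ≤ pr x) xs → minFrom z xs ≡ z
  minFrom-base z [] [] = refl
  minFrom-base z (x ∷ xs) (z≤x ∷ z≤xs) =
    trans (cong (pr x ⊓_) (minFrom-base z xs z≤xs)) (m≥n⇒m⊓n≡n z≤x)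

  ⊓-minFrom-absorb : ∀ p w xs → All (λ x → p ≤ pr x) xs → p ⊓ minFrom w xs ≡ p ⊓ w
  ⊓-minFrom-absorb p w [] [] = refl
  ⊓-minFrom-absorb p w (x ∷ xs) (p≤x ∷ p≤xs) = begin
    p ⊓ (pr x ⊓ minFrom w xs)  ≡⟨ ⊓-assoc p (pr x) _ ⟨
    (p ⊓ pr x) ⊓ minFrom w xs  ≡⟨ cong (_⊓ minFrom w xs) (m≤n⇒m⊓n≡m p≤x) ⟩
    p ⊓ minFrom w xs           ≡⟨ ⊓-minFrom-absorb p w xs p≤xs ⟩
    p ⊓ w                      ∎
    where open ≡-Reasoning

  minPr-cycle : ∀ u xs → All (λ x → pr u ≤ pr x) xs → minPr G u (xs ∷ʳ u) ≡ pr u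
  minPr-cycle u xs u≤xs = begin
    minFrom (pr u) (xs ++ [ u ])  ≡⟨ foldr-++ _ (pr u) xs [ u ] ⟩
    minFrom (pr u ⊓ pr u) xs      ≡⟨ cong (λ z → minFrom z xs) (⊓-idem (pr u)) ⟩
    minFrom (pr u) xs             ≡⟨ minFrom-base (pr u) xs u≤xs ⟩
    pr u                          ∎
    where open ≡-Reasoning

  -- The second copy of u keeps the minimum of the removed cycle u ∷ cs.
  minPr-cut : ∀ z xs u cs ys → All (λ x → pr u ≤ pr x) cs →
    minPr G z (xs ++ u ∷ cs ++ u ∷ ys) ≡ minPr G z (xs ++ u ∷ ys)
  minPr-cut z xs u cs ys u≤cs = begin
    minFrom (pr z) (xs ++ u ∷ cs ++ u ∷ ys)        ≡⟨ foldr-++ _ (pr z) xs _ ⟩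
    minFrom (pr u ⊓ minFrom (pr z) (cs ++ u ∷ ys)) xs
      ≡⟨ cong (λ w → minFrom (pr u ⊓ w) xs) (foldr-++ _ (pr z) cs (u ∷ ys)) ⟩
    minFrom (pr u ⊓ minFrom (pr u ⊓ r) cs) xs
      ≡⟨ cong (λ w → minFrom w xs) (⊓-minFrom-absorb (pr u) (pr u ⊓ r) cs u≤cs) ⟩
    minFrom (pr u ⊓ (pr u ⊓ r)) xs
      ≡⟨ cong (λ w → minFrom w xs) (trans (sym (⊓-assoc (pr u) (pr u) r)) (cong (_⊓ r) (⊓-idem (pr u)))) ⟩
    minFrom (pr u ⊓ r) xs                          ≡⟨ foldr-++ _ (pr z) xs (u ∷ ys) ⟨
    minFrom (pr z) (xs ++ u ∷ ys)                  ∎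
    where
    open ≡-Reasoning
    r = minFrom (pr z) ys

  countPr-++ : ∀ j xs ys → countPr G j (xs ++ ys) ≡ countPr G j xs + countPr G j ys
  countPr-++ j xs ys = trans (cong length (filter-++ (λ x → pr x ≟ j) xs ys)) (length-++ (filter _ xs))

  countPr-here : ∀ {j} u xs → pr u ≡ j → countPr G j (u ∷ xs) ≡ suc (countPr G j xs)
  countPr-here u xs pr≡j = cong length (filter-accept (λ x → pr x ≟ _) pr≡j)

  countPr-cut : ∀ j xs u cs ys →
    countPr G j (xs ++ u ∷ ys) + countPr G j (u ∷ cs) ≡ countPr G j (xs ++ u ∷ cs ++ u ∷ ys)
  countPr-cut j xs u cs ys = begin
    countPr G j (xs ++ u ∷ ys) + c        ≡⟨ cong (_+ c) (countPr-++ j xs (u ∷ ys)) ⟩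
    countPr G j xs + cy + c               ≡⟨ +-assoc (countPr G j xs) cy c ⟩
    countPr G j xs + (cy + c)             ≡⟨ cong (countPr G j xs +_) (+-comm cy c) ⟩
    countPr G j xs + (c + cy)             ≡⟨ cong (countPr G j xs +_) (countPr-++ j (u ∷ cs) (u ∷ ys)) ⟨
    countPr G j xs + countPr G j (u ∷ cs ++ u ∷ ys) ≡⟨ countPr-++ j xs _ ⟨
    countPr G j (xs ++ u ∷ cs ++ u ∷ ys)  ∎
    where
    open ≡-Reasoning
    c = countPr G j (u ∷ cs)
    cy = countPr G j (u ∷ ys)

  prefixMin : Play G → ℕ → ℕ
  prefixMin π k = minPr G (π 0) (pre G π (suc k))

  prefixCount : Play G → ℕ → ℕ → ℕ
  prefixCount π j k = countPr G j (pre G π (suc k))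

  pre-cong : ∀ {π ρ : Play G} n → (∀ k → k < n → π k ≡ ρ k) → pre G π n ≡ pre G ρ n
  pre-cong zero    π≡ρ = refl
  pre-cong (suc n) π≡ρ = cong₂ _∷ʳ_ (pre-cong n (λ k k<n → π≡ρ k (m<n⇒m<1+n k<n))) (π≡ρ n (n<1+n n))

  pre-+ : ∀ π m n → pre G π (m + n) ≡ pre G π m ++ pre G (suffix π m) n
  pre-+ π m zero = trans (cong (pre G π) (+-identityʳ m)) (sym (++-identityʳ _))
  pre-+ π m (suc n) = begin
    pre G π (m + suc n)                                ≡⟨ cong (pre G π) (+-suc m n) ⟩
    pre G π (m + n) ∷ʳ π (m + n)                       ≡⟨ cong (_∷ʳ π (m + n)) (pre-+ π m n) ⟩
    (pre G π m ++ pre G (suffix π m) n) ∷ʳ π (m + n)   ≡⟨ ++-assoc (pre G π m) _ _ ⟩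
    pre G π m ++ pre G (suffix π m) (suc n)            ∎
    where open ≡-Reasoning

  pre-suc : ∀ π n → pre G π (suc n) ≡ π 0 ∷ pre G (π ∘ suc) n
  pre-suc π zero    = refl
  pre-suc π (suc n) = cong (_∷ʳ π (suc n)) (pre-suc π n)

  pre-suffix-suc : ∀ π m n → pre G (suffix π m) (suc n) ≡ π m ∷ pre G (suffix π (suc m)) n
  pre-suffix-suc π m n = trans (pre-suc (suffix π m) n)
    (cong₂ _∷_ (cong π (+-identityʳ m)) (pre-cong n (λ k _ → cong π (+-suc m k))))

  ∈-pre⁺ : ∀ π {k n} → k < n → π k ∈ pre G π n
  ∈-pre⁺ π {k} {suc n} k<1+n with m<1+n⇒m<n∨m≡n k<1+n
  ... | inj₁ k<n  = ∈-++⁺ˡ (∈-pre⁺ π k<n)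
  ... | inj₂ refl = ∈-++⁺ʳ (pre G π n) (here refl)

  ∈-pre⁻ : ∀ π n {x} → x ∈ pre G π n → ∃ λ k → k < n × π k ≡ x
  ∈-pre⁻ π (suc n) x∈ with ∈-++⁻ (pre G π n) x∈
  ... | inj₁ x∈pre = let k , k<n , πk≡x = ∈-pre⁻ π n x∈pre in k , m<n⇒m<1+n k<n , πk≡x
  ... | inj₂ (here x≡πn) = n , n<1+n n , sym x≡πn

  prefixMin-≤ : ∀ π {k K} → k ≤ K → prefixMin π K ≤ pr (π k)
  prefixMin-≤ π k≤K = minFrom-≤-∈ _ _ (∈-pre⁺ π (s≤s k≤K))

  countPr-pre-mono : ∀ j π {m n} → m ≤ n → countPr G j (pre G π m) ≤ countPr G j (pre G π n)
  countPr-pre-mono j π {m} m≤n with m≤n⇒∃[o]m+o≡n m≤n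
  ... | o , refl = begin
    countPr G j (pre G π m)                                          ≤⟨ m≤m+n _ _ ⟩
    countPr G j (pre G π m) + countPr G j (pre G (suffix π m) o)     ≡⟨ countPr-++ j (pre G π m) _ ⟨
    countPr G j (pre G π m ++ pre G (suffix π m) o)                  ≡⟨ cong (countPr G j) (pre-+ π m o) ⟨
    countPr G j (pre G π (m + o))                                    ∎
    where open ≤-Reasoning

  countPr-pre-suc : ∀ {j} π n → pr (π n) ≡ j → countPr G j (pre G π (suc n)) ≡ suc (countPr G j (pre G π n))
  countPr-pre-suc {j} π n pr≡j =
    trans (countPr-++ j (pre G π n) [ π n ])
      (trans (cong (countPr G j (pre G π n) +_) (countPr-here (π n) [] pr≡j)) (+-comm _ 1))

  cons-pre-isPath : ∀ π → (∀ k → E (π k) (π (suc k))) → ∀ n → IsPath G (π 0 ∷ pre G (π ∘ suc) n)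
  cons-pre-isPath π edge zero = tt
  cons-pre-isPath π edge (suc n) rewrite pre-suc (π ∘ suc) n = edge 0 , cons-pre-isPath (π ∘ suc) (edge ∘ suc) n

  pre-isPath : ∀ π → (∀ k → E (π k) (π (suc k))) → ∀ n → IsPath G (pre G π n)
  pre-isPath π edge zero = tt
  pre-isPath π edge (suc n) rewrite pre-suc π n = cons-pre-isPath π edge n

  repeat⊎unique : ∀ {P : V G → Set} (P? : Decidable P) π n →
    (∃₂ λ a b → a < b × b < n × π a ≡ π b × P (π a)) ⊎ Unique (filter P? (pre G π n))
  repeat⊎unique P? π zero = inj₂ []
  repeat⊎unique {P} P? π (suc n) with repeat⊎unique P? π n
  ... | inj₁ (a , b , a<b , b<n , πa≡πb , pa) = inj₁ (a , b , a<b , m<n⇒m<1+n b<n , πa≡πb , pa)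
  ... | inj₂ unique with P? (π n) | π n ∈? pre G π n
  ...   | no ¬p | _ = inj₂ (subst Unique (sym dropped) unique)
    where
    dropped : filter P? (pre G π (suc n)) ≡ filter P? (pre G π n)
    dropped = trans (filter-++ P? (pre G π n) [ π n ])
                (trans (cong (filter P? (pre G π n) ++_) (filter-reject P? ¬p)) (++-identityʳ _))
  ...   | yes p | yes πn∈ = let a , a<n , πa≡πn = ∈-pre⁻ π n πn∈ in
    inj₁ (a , n , a<n , n<1+n n , πa≡πn , subst P (sym πa≡πn) p)
  ...   | yes p | no πn∉ = inj₂ (subst Unique (sym kept) (Unique.++⁺ unique ([] ∷ []) disjoint))
    where
    kept : filter P? (pre G π (suc n)) ≡ filter P? (pre G π n) ++ [ π n ]
    kept = trans (filter-++ P? (pre G π n) [ π n ]) (cong (filter P? (pre G π n) ++_) (filter-accept P? p))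
    disjoint : ∀ {x} → ¬ (x ∈ filter P? (pre G π n) × x ∈ [ π n ])
    disjoint (x∈ , here refl) = πn∉ (proj₁ (∈-filter⁻ P? x∈))

  crowded⇒repeat : ∀ π n i → sizeV G i < countPr G i (pre G π n) →
    ∃₂ λ a b → a < b × b < n × π a ≡ π b × pr (π a) ≡ i
  crowded⇒repeat π n i size<count with repeat⊎unique (λ x → pr x ≟ i) π n
  ... | inj₁ repeat = repeat
  ... | inj₂ unique = ⊥-elim (<⇒≱ size<count (Unique-⊆⇒length≤ unique filter⊆V))
    where
    filter⊆V : filter (λ x → pr x ≟ i) (pre G π n) ⊆ filter (λ x → pr x ≟ i) (allFin _)
    filter⊆V x∈ =
      ∈-filter⁺ (λ x → pr x ≟ i) (∈-allFin _) (proj₂ (∈-filter⁻ (λ x → pr x ≟ i) {xs = pre G π n} x∈))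

  module _ {π ρ : Play G} {a δ : ℕ} (shifted : ∀ j → a ≤ j → ρ j ≡ π (j + δ)) where

    InfOften-unshift : ∀ {p} → InfOften G ρ p → InfOften G π p
    InfOften-unshift often m with often (m + a)
    ... | k , m+a≤k , prk≡p = k + δ , ≤-trans (m≤m+n m a) (≤-trans m+a≤k (m≤m+n k δ)) ,
          trans (cong pr (sym (shifted k (≤-trans (m≤n+m a m) m+a≤k)))) prk≡p

    InfOften-shift : ∀ {p} → InfOften G π p → InfOften G ρ p
    InfOften-shift often m with often (m + a + δ)
    ... | k , m+a+δ≤k , prk≡p = k ∸ δ , ≤-trans (m≤m+n m a) m+a≤k∸δ ,
          trans (cong pr (trans (shifted (k ∸ δ) (≤-trans (m≤n+m a m) m+a≤k∸δ)) (cong π (m∸n+n≡m δ≤k))))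
                prk≡p
      where
      m+a≤k∸δ : m + a ≤ k ∸ δ
      m+a≤k∸δ = m+n≤o⇒m≤o∸n (m + a) m+a+δ≤k
      δ≤k : δ ≤ k
      δ≤k = ≤-trans (m≤n+m δ (m + a)) m+a+δ≤k

    WonByEven-shift : WonByEven G π → WonByEven G ρ
    WonByEven-shift (p , (often , least) , even) =
      p , (InfOften-shift often , λ q q<p → least q q<p ∘ InfOften-unshift) , even

  MaxCount-elim : ∀ {π j c} (P : ℕ → Set) → MaxCount G π j c → P 0 →
    (∀ k → prefixMin π k ≡ j → P (prefixCount π j k)) → P c
  MaxCount-elim P (_ , inj₁ (k , min≡j , count≡c)) P0 Pk = subst P count≡c (Pk k min≡j)
  MaxCount-elim P (_ , inj₂ (_ , c≡0)) P0 Pk = subst P (sym c≡0) P0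

  ¬¬-MaxCount : ∀ π j b → (∀ k → prefixMin π k ≡ j → prefixCount π j k ≤ b) →
    ¬ ¬ ∃ (MaxCount G π j)
  ¬¬-MaxCount π j b bounded = do
    c , upper , attained ← ¬¬-greatest Attained b λ { x (k , min≡j , refl) → bounded k min≡j }
    pure (c , (λ k min≡j → upper _ (k , min≡j , refl)) ,
              map₂ (λ (none , c≡0) → (λ k min≡j → none _ (k , min≡j , refl)) , c≡0) attained)
    where
    Attained : ℕ → Set
    Attained x = ∃ λ k → prefixMin π k ≡ j × prefixCount π j k ≡ x

  IsValueVector : Play G → Vec ℕ (d G) → Set
  IsValueVector π g = (∀ j → IsEven (toℕ j) → lookup g j ≡ 0) ×
                      (∀ j → IsOdd (toℕ j) → MaxCount G π (toℕ j) (lookup g j))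

  ¬¬-valueVector : ∀ π (h : Vec ℕ (d G)) →
    (∀ j → IsOdd (toℕ j) → ∀ k → prefixMin π k ≡ toℕ j → prefixCount π (toℕ j) k ≤ lookup h j) →
    ¬ ¬ (∃ λ g → IsValueVector π g × (∀ j → lookup g j ≤ lookup h j))
  ¬¬-valueVector π h bounded = do
    g , entries ← ¬¬-finite-choice Entry entry
    pure (g , ((proj₁ ∘ entries) , (proj₁ ∘ proj₂ ∘ entries)) , (proj₂ ∘ proj₂ ∘ entries))
    where
    Entry : Fin (d G) → ℕ → Set
    Entry j c = (IsEven (toℕ j) → c ≡ 0) × (IsOdd (toℕ j) → MaxCount G π (toℕ j) c) × c ≤ lookup h j
    entry : ∀ j → ¬ ¬ ∃ (Entry j)
    entry j = ¬¬-excluded-middle >>= λ where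
      (yes odd) → do
        c , max ← ¬¬-MaxCount π (toℕ j) (lookup h j) (bounded j odd)
        pure (c , (λ even → ⊥-elim (even∧odd⇒⊥ even odd)) , (λ _ → max) ,
                  MaxCount-elim (_≤ lookup h j) max z≤n (bounded j odd))
      (no ¬odd) → pure (0 , (λ _ → refl) , (λ odd → ⊥-elim (¬odd odd)) , z≤n)

+-shift-past-cycle : ∀ a k e → a + k + suc e ≡ suc (a + e) + k
+-shift-past-cycle = solve-∀

+-split-around-cycle : ∀ a t e → suc (a + t + suc e) ≡ a + suc (e + suc t)
+-split-around-cycle = solve-∀

module CycleCut (G : Game) (s : OddStrategy G) (oblivious : Oblivious G s)
  {v : V G} {π : Play G} (π∈ : InPlays G s v π) (a e : ℕ) (loop : π a ≡ π (suc (a + e)))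
  (dominated : All (λ x → Game.pr G (π a) ≤ Game.pr G x) (pre G (suffix π (suc a)) e))
  (odd : IsOdd (Game.pr G (π a))) where
  open Game G using (E; pr; owner)
  open OddStrategy s using (σ)
  open PlayFacts G

  -- The cycle u ∷ inner occupies the positions a … a + e, and u recurs at a + δ;
  -- cut skips exactly these δ positions.
  δ : ℕ
  δ = suc e

  u : V G
  u = π a

  inner : List (V G)
  inner = pre G (suffix π (suc a)) e

  after : ℕ → List (V G)
  after t = pre G (suffix π (suc (suc (a + e)))) t

  cut : Play G
  cut j with j <? a
  ... | yes _ = π j
  ... | no  _ = π (j + δ)

  cut-agree : ∀ j → j ≤ a → cut j ≡ π j
  cut-agree j j≤a with j <? a
  ... | yes _ = refl
  ... | no j≮a with ≤-antisym j≤a (≮⇒≥ j≮a)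
  ...   | refl = trans (cong π (+-suc a e)) (sym loop)

  cut-shift : ∀ j → a ≤ j → cut j ≡ π (j + δ)
  cut-shift j a≤j with j <? a
  ... | yes j<a = ⊥-elim (<⇒≱ j<a a≤j)
  ... | no  _   = refl

  start : cut 0 ≡ π 0
  start = cut-agree 0 z≤n

  pre-cut-low : ∀ n → n ≤ a → pre G cut n ≡ pre G π n
  pre-cut-low n n≤a = pre-cong n (λ k k<n → cut-agree k (≤-trans (<⇒≤ k<n) n≤a))

  pre-cut-high : ∀ t → pre G cut (suc (a + t)) ≡ pre G π a ++ u ∷ after t
  pre-cut-high t = begin
    pre G cut (suc (a + t))                          ≡⟨ cong (pre G cut) (+-suc a t) ⟨
    pre G cut (a + suc t)                            ≡⟨ pre-+ cut a (suc t) ⟩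
    pre G cut a ++ pre G (suffix cut a) (suc t)
      ≡⟨ cong₂ _++_ (pre-cut-low a ≤-refl) (pre-cong (suc t) shifted) ⟩
    pre G π a ++ pre G (suffix π (suc (a + e))) (suc t)
      ≡⟨ cong (pre G π a ++_) (pre-suffix-suc π (suc (a + e)) t) ⟩
    pre G π a ++ π (suc (a + e)) ∷ after t           ≡⟨ cong (λ w → pre G π a ++ w ∷ after t) loop ⟨
    pre G π a ++ u ∷ after t                         ∎
    where
    open ≡-Reasoning
    shifted : ∀ k → k < suc t → cut (a + k) ≡ π (suc (a + e) + k)
    shifted k _ = trans (cut-shift (a + k) (m≤m+n a k)) (cong π (+-shift-past-cycle a k e))

  pre-uncut : ∀ t → pre G π (suc (a + t + δ)) ≡ pre G π a ++ u ∷ inner ++ u ∷ after t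
  pre-uncut t = begin
    pre G π (suc (a + t + δ))                            ≡⟨ cong (pre G π) (+-split-around-cycle a t e) ⟩
    pre G π (a + suc (e + suc t))                        ≡⟨ pre-+ π a _ ⟩
    pre G π a ++ pre G (suffix π a) (suc (e + suc t))    ≡⟨ cong (pre G π a ++_) (pre-suffix-suc π a _) ⟩
    pre G π a ++ u ∷ pre G (suffix π (suc a)) (e + suc t)
      ≡⟨ cong (λ w → pre G π a ++ u ∷ w) (pre-+ (suffix π (suc a)) e (suc t)) ⟩
    pre G π a ++ u ∷ inner ++ pre G (suffix (suffix π (suc a)) e) (suc t)
      ≡⟨ cong (λ w → pre G π a ++ u ∷ inner ++ w) (pre-cong (suc t) λ k _ → cong (π ∘ suc) (sym (+-assoc a e k))) ⟩
    pre G π a ++ u ∷ inner ++ pre G (suffix π (suc (a + e))) (suc t)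
      ≡⟨ cong (λ w → pre G π a ++ u ∷ inner ++ w) (pre-suffix-suc π (suc (a + e)) t) ⟩
    pre G π a ++ u ∷ inner ++ π (suc (a + e)) ∷ after t
      ≡⟨ cong (λ w → pre G π a ++ u ∷ inner ++ w ∷ after t) loop ⟨
    pre G π a ++ u ∷ inner ++ u ∷ after t                ∎
    where open ≡-Reasoning

  π-edge : ∀ j → E (π j) (π (suc j))
  π-edge = proj₁ (proj₂ π∈)

  odd-dominated : OddDominatedCycle G u inner
  odd-dominated = subst (IsPath G) cycle≡ (pre-isPath (suffix π a) edge (suc (suc e))) ,
                  subst IsOdd (sym (minPr-cycle u inner dominated)) odd
    where
    edge : ∀ k → E (π (a + k)) (π (a + suc k))
    edge k = subst (E (π (a + k)) ∘ π) (sym (+-suc a k)) (π-edge (a + k))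
    cycle≡ : pre G (suffix π a) (suc (suc e)) ≡ u ∷ inner ∷ʳ u
    cycle≡ = trans (pre-suffix-suc π a (suc e)) (cong (λ w → u ∷ inner ∷ʳ w) (sym loop))

  below⊎above : ∀ j → suc j ≤ a ⊎ a ≤ j
  below⊎above j with j <? a
  ... | yes j<a = inj₁ j<a
  ... | no  j≮a = inj₂ (≮⇒≥ j≮a)

  cut-InPlays : InPlays G s v cut
  cut-InPlays = trans start (proj₁ π∈) , cut-edge , cut-σ
    where
    cut-edge : ∀ j → E (cut j) (cut (suc j))
    cut-edge j with below⊎above j
    ... | inj₁ 1+j≤a =
      subst₂ E (sym (cut-agree j (≤-trans (n≤1+n j) 1+j≤a))) (sym (cut-agree (suc j) 1+j≤a)) (π-edge j)
    ... | inj₂ a≤j   =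
      subst₂ E (sym (cut-shift j a≤j)) (sym (cut-shift (suc j) (m≤n⇒m≤1+n a≤j))) (π-edge (j + δ))

    cut-σ : ∀ j → owner (cut j) ≡ Odd → cut (suc j) ≡ σ (pre G cut (suc j))
    cut-σ j own with below⊎above j
    ... | inj₁ 1+j≤a = begin
      cut (suc j)            ≡⟨ cut-agree (suc j) 1+j≤a ⟩
      π (suc j)
        ≡⟨ proj₂ (proj₂ π∈) j (trans (cong owner (sym (cut-agree j (≤-trans (n≤1+n j) 1+j≤a)))) own) ⟩
      σ (pre G π (suc j))    ≡⟨ cong σ (pre-cut-low (suc j) 1+j≤a) ⟨
      σ (pre G cut (suc j))  ∎
      where open ≡-Reasoning
    ... | inj₂ a≤j with m≤n⇒∃[o]m+o≡n a≤j
    ...   | t , refl = begin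
      cut (suc (a + t))                              ≡⟨ cut-shift (suc (a + t)) (m≤n⇒m≤1+n (m≤m+n a t)) ⟩
      π (suc (a + t + δ))                            ≡⟨ proj₂ (proj₂ π∈) (a + t + δ) own′ ⟩
      σ (pre G π (suc (a + t + δ)))                  ≡⟨ cong σ (pre-uncut t) ⟩
      σ (pre G π a ++ u ∷ inner ++ u ∷ after t)
        ≡⟨ oblivious (pre G π a) u inner (after t) (π (a + t + δ)) path last own′ odd-dominated ⟩
      σ (pre G π a ++ u ∷ after t)                   ≡⟨ cong σ (pre-cut-high t) ⟨
      σ (pre G cut (suc (a + t)))                    ∎
      where
      open ≡-Reasoning
      own′ : owner (π (a + t + δ)) ≡ Odd
      own′ = trans (cong owner (sym (cut-shift (a + t) (m≤m+n a t)))) own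
      path : IsPath G (pre G π a ++ u ∷ inner ++ u ∷ after t)
      path = subst (IsPath G) (pre-uncut t) (pre-isPath π π-edge (suc (a + t + δ)))
      last : Last G (pre G π a ++ u ∷ inner ++ u ∷ after t) (π (a + t + δ))
      last = pre G π (a + t + δ) , sym (pre-uncut t)

  cut-WonByEven : WonByEven G π → WonByEven G cut
  cut-WonByEven = WonByEven-shift cut-shift

  cut-prefix : ∀ k →
    (suc k ≤ a × prefixMin cut k ≡ prefixMin π k × (∀ j → prefixCount cut j k ≡ prefixCount π j k))
    ⊎ (prefixMin cut k ≡ prefixMin π (k + δ) ×
       (∀ j → prefixCount cut j k + countPr G j (u ∷ inner) ≡ prefixCount π j (k + δ)))
  cut-prefix k with below⊎above k
  ... | inj₁ 1+k≤a = inj₁ (1+k≤a , cong₂ (minPr G) start (pre-cut-low (suc k) 1+k≤a) ,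
                          λ j → cong (countPr G j) (pre-cut-low (suc k) 1+k≤a))
  ... | inj₂ a≤k with m≤n⇒∃[o]m+o≡n a≤k
  ...   | t , refl = inj₂ (min≡ , count≡)
    where
    min≡ : prefixMin cut (a + t) ≡ prefixMin π (a + t + δ)
    min≡ = begin
      minPr G (cut 0) (pre G cut (suc (a + t)))             ≡⟨ cong₂ (minPr G) start (pre-cut-high t) ⟩
      minPr G (π 0) (pre G π a ++ u ∷ after t)
        ≡⟨ minPr-cut (π 0) (pre G π a) u inner (after t) dominated ⟨
      minPr G (π 0) (pre G π a ++ u ∷ inner ++ u ∷ after t) ≡⟨ cong (minPr G (π 0)) (pre-uncut t) ⟨
      minPr G (π 0) (pre G π (suc (a + t + δ)))             ∎
      where open ≡-Reasoning
    count≡ : ∀ j → prefixCount cut j (a + t) + countPr G j (u ∷ inner) ≡ prefixCount π j (a + t + δ)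
    count≡ j = trans (cong (λ w → countPr G j w + countPr G j (u ∷ inner)) (pre-cut-high t))
                 (trans (countPr-cut j (pre G π a) u inner (after t)) (cong (countPr G j) (sym (pre-uncut t))))

module MinimalValue (G : Game) (s : OddStrategy G) (oblivious : Oblivious G s) {v : V G}
  {f : Vec ℕ (d G)} (minimal : ∀ ρ t → InPlays G s v ρ → PlayValue G ρ t → _≤M_ G (tup f) t) where
  open Game G using (pr)
  open PlayFacts G

  no-smaller-play : ∀ ρ → InPlays G s v ρ → WonByEven G ρ → ∀ i → IsOdd (toℕ i) → 0 < lookup f i →
    (∀ j → IsOdd (toℕ j) → ∀ k → prefixMin ρ k ≡ toℕ j → prefixCount ρ (toℕ j) k ≤ lookup f j) →
    (∀ k → prefixMin ρ k ≡ toℕ i → prefixCount ρ (toℕ i) k < lookup f i) → ⊥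
  no-smaller-play ρ ρ∈ won i odd-i 0<fi bounded strict =
    ¬¬-valueVector ρ f bounded λ (g , (g-even , g-odd) , g≤f) →
      pointwise≤∧<⇒¬LexLeq f g i g≤f (MaxCount-elim (_< lookup f i) (g-odd i odd-i) 0<fi strict)
        (minimal ρ (tup g) ρ∈ (inj₂ (won , g , refl , g-even , g-odd)))

  module _ {π : Play G} (π∈ : InPlays G s v π) (won : WonByEven G π)
           (f-odd : ∀ j → IsOdd (toℕ j) → MaxCount G π (toℕ j) (lookup f j)) where

    odd-entry-bounded : ∀ i → IsOdd (toℕ i) → ¬ sizeV G (toℕ i) < lookup f i
    odd-entry-bounded i odd-i size<fi with f-odd i odd-i
    ... | _ , inj₂ (_ , fi≡0) = <⇒≱ size<fi (subst (_≤ _) (sym fi≡0) z≤n)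
    ... | _ , inj₁ (K , min≡i , count≡fi)
      with crowded⇒repeat π (suc K) (toℕ i) (subst (sizeV G (toℕ i) <_) (sym count≡fi) size<fi)
    ...   | a , b , a<b , b<1+K , πa≡πb , pr≡i with m≤n⇒∃[o]m+o≡n a<b
    ...     | e , refl =
      no-smaller-play cut cut-InPlays (cut-WonByEven won) i odd-i (≤-<-trans z≤n size<fi) bounded strict
      where
      b≤K : suc (a + e) ≤ K
      b≤K = ≤-pred b<1+K

      dominated : All (λ x → pr (π a) ≤ pr x) (pre G (suffix π (suc a)) e)
      dominated = All.tabulate λ x∈ → let t , t<e , πt≡x = ∈-pre⁻ (suffix π (suc a)) e x∈ in
        subst (λ x → pr (π a) ≤ pr x) πt≡x
          (subst (_≤ pr (π (suc a + t))) (trans min≡i (sym pr≡i))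
            (prefixMin-≤ π (<⇒≤ (<-≤-trans (+-monoʳ-< (suc a) t<e) b≤K))))

      open CycleCut G s oblivious π∈ a e πa≡πb dominated (subst IsOdd (sym pr≡i) odd-i)

      before-cycle : countPr G (toℕ i) (pre G π a) < lookup f i
      before-cycle = begin-strict
        countPr G (toℕ i) (pre G π a)          <⟨ n<1+n _ ⟩
        suc (countPr G (toℕ i) (pre G π a))    ≡⟨ countPr-pre-suc π a pr≡i ⟨
        countPr G (toℕ i) (pre G π (suc a))    ≤⟨ countPr-pre-mono (toℕ i) π (m≤n⇒m≤1+n (<-≤-trans a<b b≤K)) ⟩
        prefixCount π (toℕ i) K                ≡⟨ count≡fi ⟩
        lookup f i                             ∎
        where open ≤-Reasoning

      bounded : ∀ j → IsOdd (toℕ j) → ∀ k → prefixMin cut k ≡ toℕ j →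
                prefixCount cut (toℕ j) k ≤ lookup f j
      bounded j odd-j k min≡j with cut-prefix k
      ... | inj₁ (_ , min≡ , count≡) =
        subst (_≤ lookup f j) (sym (count≡ (toℕ j))) (proj₁ (f-odd j odd-j) k (trans (sym min≡) min≡j))
      ... | inj₂ (min≡ , count≡) = ≤-trans (m≤m+n _ _)
        (subst (_≤ lookup f j) (sym (count≡ (toℕ j))) (proj₁ (f-odd j odd-j) (k + δ) (trans (sym min≡) min≡j)))

      strict : ∀ k → prefixMin cut k ≡ toℕ i → prefixCount cut (toℕ i) k < lookup f i
      strict k min≡i′ with cut-prefix k
      ... | inj₁ (1+k≤a , _ , count≡) = begin-strict
        prefixCount cut (toℕ i) k              ≡⟨ count≡ (toℕ i) ⟩
        prefixCount π (toℕ i) k                ≤⟨ countPr-pre-mono (toℕ i) π 1+k≤a ⟩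
        countPr G (toℕ i) (pre G π a)          <⟨ before-cycle ⟩
        lookup f i                             ∎
        where open ≤-Reasoning
      ... | inj₂ (min≡ , count≡) = begin-strict
        prefixCount cut (toℕ i) k              <⟨ m<m+n _ (subst (0 <_) (sym (countPr-here u inner pr≡i)) z<s) ⟩
        prefixCount cut (toℕ i) k + countPr G (toℕ i) (u ∷ inner) ≡⟨ count≡ (toℕ i) ⟩
        prefixCount π (toℕ i) (k + δ)          ≤⟨ proj₁ (f-odd i odd-i) (k + δ) (trans (sym min≡) min≡i′) ⟩
        lookup f i                             ∎
        where open ≤-Reasoning

lemma3 : (G : Game) (v : Fin (Game.n G)) (s : OddStrategy G) →
         Oblivious G s →
         (m : Meas G) → IsMinValue G s v m → InM G m
lemma3 G v s oblivious top _ = tt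
lemma3 G v s oblivious (tup f) ((π , π∈ , inj₁ (_ , ())) , _)
lemma3 G v s oblivious (tup f) ((π , π∈ , inj₂ (won , .f , refl , f-even , f-odd)) , minimal) =
  f-even , λ i odd-i → ≮⇒≥ (odd-entry-bounded π∈ won f-odd i odd-i)
  where open MinimalValue G s oblivious minimal
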